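{- Every tall tame critical easel $(\mathcal G,z,x,\psi)$ satisfies $|V(\mathcal G)|\ge 4$.
   Context: Graphs are finite, loopless, may have parallel edges. A $\mathbb{Z}_3$-boundary of $G$ is $\beta:V(G)\to\mathbb{Z}_3$ summing to $0$ over every component; $\mathcal G=(G,\beta)$ is a $\mathbb{Z}_3$-bordered graph. A nowhere-zero flow is an orientation with $\deg^+(v)-\deg^-(v)\equiv\beta(v)\pmod 3$ for every $v$. For a vertex $v$, $|\tau(v)|$ is $0$ if $\deg(v)$ even and $\beta(v)=0$; $2$ if $\deg(v)$ even and $\beta(v)\ne0$; $3$ if $\deg(v)$ odd and $\beta(v)=0$; $1$ if $\deg(v)$ odd and $\beta(v)\ne0$. For a partition $\mathcal P$ of $V(G)$, $\mathcal G/\mathcal P$ identifies each part into one vertex, deletes loops and sums $\beta$ over parts; $\mathcal P$ is non-trivial if some part has $\ge2$ vertices. A canvas $(\mathcal G,z)$ is a $\mathbb{Z}_3$-bordered graph with tip $z$. A tip preflow is an orientation $\psi$ of the edges at $z$ with (in $\psi$) $\deg^+(z)-\deg^-(z)\equiv\beta(z)\pmod 3$; it extends if some nowhere-zero flow agrees with it at $z$. $\mathcal P$ is tip-respecting if $\{z\}$ is a part. The canvas is $\psi$-critical if $\psi$ does not extend in $\mathcal G$ but extends in $\mathcal G/\mathcal P$ for every non-trivial tip-respecting $\mathcal P$. An easel is $(\mathcal G,z,x,\psi)$ with $(\mathcal G,z)$ a canvas, $x\ne z$ a vertex, $\psi$ a tip preflow; it is tame if $\deg(v)\ge4+|\tau(v)|$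 for all $v\notin\{x,z\}$; tall if $\deg(z)\le\deg(x)+2$ and, when $\deg(z)=\deg(x)+2$, $\psi$ directs some edge incident with $z$ but not $x$ towards $z$ and another such edge away from $z$; critical if $(\mathcal G,z)$ is $\psi$-critical. -}

module Defs where

open import Data.Nat using (ℕ; zero; suc; _+_; _≤_; _%_)
open import Data.Nat.DivMod using (_mod_)
import Data.Nat.Divisibility as ND
open import Data.Integer as ℤ using (ℤ; +_; _-_)
open import Data.Integer.Divisibility using (_∣_)
open import Data.Fin using (Fin; toℕ; _≟_)
open import Data.Fin.Properties using () renaming (_≟_ to _≟F_)
open import Data.Bool using (Bool; true; false; if_then_else_; _∨_; _∧_; not)
open import Data.List using (List; []; _∷_; length; filterᵇ; map; zipWith; allFin)
open import Data.Nat.ListAction using (sum)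
import Data.List as L
open import Data.List.Membership.Propositional using (_∈_)
open import Data.List.Relation.Unary.All using (All)
open import Data.Product using (Σ; _×_; _,_; proj₁; proj₂; ∃; ∃-syntax; swap; map₁; map₂)
open import Data.Sum using (_⊎_)
open import Relation.Nullary using (¬_; does)
open import Relation.Binary.PropositionalEquality using (_≡_; _≢_)
open import Function.Bundles using (_⇔_)
open import Function using (Surjective)

-- Multigraphs on vertex set Fin n, given by a list of edges (pairs of
-- endpoints; parallel edges = repeated entries).  The list order fixes an
-- orientation reference for each edge.

Edges : ℕ → Set
Edges n = List (Fin n × Fin n)

Loopless : ∀ {n} → Edges n → Set
Loopless E = All (λ e → proj₁ e ≢ proj₂ e) E

_==_ : ∀ {n} → Fin n → Fin n → Bool
u == v = does (u ≟F v)

deg : ∀ {n} → Edges n → Fin n → ℕ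
deg [] v = 0
deg (e ∷ E) v = (if proj₁ e == v then 1 else 0) + (if proj₂ e == v then 1 else 0) + deg E v

Z3 : Set
Z3 = Fin 3

_≡₃_ : ℤ → ℤ → Set
a ≡₃ b = (+ 3) ∣ (a - b)

data Reach {n} (E : Edges n) (u : Fin n) : Fin n → Set where
  here : Reach E u u
  step : ∀ {w v} → Reach E u w → ((w , v) ∈ E ⊎ (v , w) ∈ E) → Reach E u v

sumOver : ∀ {n} → (Fin n → Bool) → (Fin n → Z3) → ℕ
sumOver {n} S β = sum (map (λ v → if S v then toℕ (β v) else 0) (allFin n))

-- β sums to 0 (in Z3) over every component (S = the component of u)
IsBoundary : ∀ {n} → Edges n → (Fin n → Z3) → Set
IsBoundary {n} E β = ∀ (u : Fin n) (S : Fin n → Bool) →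
  (∀ v → (S v ≡ true) ⇔ Reach E u v) → 3 ND.∣ sumOver S β

-- Orientations: a list of Bools (true = keep the listed direction).

orient : ∀ {n} → Edges n → List Bool → Edges n
orient = zipWith (λ e b → if b then e else swap e)

outdeg indeg : ∀ {n} → Edges n → Fin n → ℕ
outdeg D v = length (filterᵇ (λ d → proj₁ d == v) D)
indeg D v = length (filterᵇ (λ d → proj₂ d == v) D)

excess : ∀ {n} → Edges n → Fin n → ℤ
excess D v = (+ outdeg D v) - (+ indeg D v)

-- nowhere-zero flow (w.r.t. boundary β): orientation with out - in ≡ β(v) mod 3
IsNZFlow : ∀ {n} → Edges n → (Fin n → Z3) → List Bool → Set
IsNZFlow E β O = (length O ≡ length E) ×
  (∀ v → excess (orient E O) v ≡₃ (+ toℕ (β v)))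

atZ : ∀ {n} → Fin n → Fin n × Fin n → Bool
atZ z e = (proj₁ e == z) ∨ (proj₂ e == z)

zEdges : ∀ {n} → Edges n → Fin n → Edges n
zEdges E z = filterᵇ (atZ z) E

IsTipPreflow : ∀ {n} → Edges n → (Fin n → Z3) → Fin n → List Bool → Set
IsTipPreflow E β z ψ = (length ψ ≡ length (zEdges E z)) ×
  (excess (orient (zEdges E z) ψ) z ≡₃ (+ toℕ (β z)))

Extends : ∀ {n} → Edges n → (Fin n → Z3) → Fin n → List Bool → Set
Extends E β z ψ = Σ (List Bool) λ O → IsNZFlow E β O ×
  (filterᵇ (atZ z) (orient E O) ≡ orient (zEdges E z) ψ)

-- Partitions as surjections p : Fin n → Fin k (parts = fibres), and
-- the quotient G/P (identify parts, delete loops, sum β over parts).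

NonTrivial : ∀ {n k} → (Fin n → Fin k) → Set
NonTrivial p = ∃[ u ] ∃[ v ] (u ≢ v × p u ≡ p v)

TipRespecting : ∀ {n k} → (Fin n → Fin k) → Fin n → Set
TipRespecting p z = ∀ v → p v ≡ p z → v ≡ z

quotEdges : ∀ {n k} → (Fin n → Fin k) → Edges n → Edges k
quotEdges p E = filterᵇ (λ e → not (proj₁ e == proj₂ e))
                        (map (λ e → (p (proj₁ e) , p (proj₂ e))) E)

quotβ : ∀ {n k} → (Fin n → Fin k) → (Fin n → Z3) → Fin k → Z3
quotβ p β j = sumOver (λ v → p v == j) β mod 3

-- For a tip-respecting partition the edges at p z in
-- G/P are exactly the images of the edges at z, in the same order, so the
-- same list ψ is the induced tip preflow of G/P.
IsCritical : ∀ {n} → Edges n → (Fin n → Z3) → Fin n → List Bool → Set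
IsCritical {n} E β z ψ =
  ¬ Extends E β z ψ ×
  (∀ (k : ℕ) (p : Fin n → Fin k) → Surjective _≡_ _≡_ p →
     NonTrivial p → TipRespecting p z →
     Extends (quotEdges p E) (quotβ p β) (p z) ψ)

tau : ∀ {n} → Edges n → (Fin n → Z3) → Fin n → ℕ
tau E β v with does (deg E v % 2 Data.Nat.≟ 0) | does (β v ≟F Data.Fin.zero)
... | true  | true  = 0
... | true  | false = 2
... | false | true  = 3
... | false | false = 1

record Easel (n : ℕ) : Set where
  field
    E        : Edges n
    β        : Fin n → Z3
    z x      : Fin n
    ψ        : List Bool
    loopless : Loopless E
    boundary : IsBoundary E β
    x≢z      : x ≢ z
    preflow  : IsTipPreflow E β z ψ

module _ {n : ℕ} (G : Easel n) where
  open Easel G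

  Tame : Set
  Tame = ∀ v → v ≢ x → v ≢ z → 4 + tau E β v ≤ deg E v

  Tall : Set
  Tall = (deg E z ≤ deg E x + 2) ×
         (deg E z ≡ deg E x + 2 →
           (∃[ d ] (d ∈ orient (zEdges E z) ψ × proj₂ d ≡ z × proj₁ d ≢ x)) ×
           (∃[ d ] (d ∈ orient (zEdges E z) ψ × proj₁ d ≡ z × proj₂ d ≢ x)))

  Critical : Set
  Critical = IsCritical E β z ψ

-- For n ≤ 3 the preflow ψ extends, contradicting criticality.  The tip z is balanced by ψ itself,
-- and once every vertex other than x is balanced so is x: the excesses sum to 0, and so does β,
-- because x reaches every vertex except possibly an isolated z.  On two vertices nothing else needs
-- balancing.  On three vertices z, x, v the edges not at z join x and v; orienting k of these c
-- edges away from v shifts the excess at v by 2k, so some k ≤ 2 balances v as soon as c ≥ 2.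
-- Tallness and tameness at v rule out c = 0, and for c = 1 they force deg v = 4, β(v) = 0 and ψ
-- to orient one z–v edge each way, after which the single x–v edge balances v.
module Submission where

open import Defs
open import Algebra.Properties.CommutativeSemigroup as CommutativeSemigroupProperties using ()
open import Data.Bool using (Bool; true; false; if_then_else_; not; _∨_; T)
open import Data.Bool.Properties using (∨-comm; ∨-zeroʳ; T?)
open import Data.Empty using (⊥-elim)
open import Data.Fin using (Fin; zero; suc; toℕ)
open import Data.Fin.Properties using () renaming (_≟_ to _≟F_)
import Data.Integer as ℤ
open import Data.Integer using () renaming (+_ to pos)
import Data.Integer.Divisibility.Signed as ℤ∣
import Data.Integer.Properties as ℤ
import Data.Integer.Tactic.RingSolver as ℤ-Solver
open import Data.List using (List; []; _∷_; length; filterᵇ; map; drop; allFin)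
open import Data.List.Properties using (map-cong; map-tabulate; filter-some)
open import Data.List.Membership.Propositional using (_∈_)
open import Data.List.Membership.Propositional.Properties using (∈-filter⁺; ∈-filter⁻)
open import Data.List.Relation.Unary.All using (All; []; _∷_)
import Data.List.Relation.Unary.All as All
open import Data.List.Relation.Unary.All.Properties using (all-filter; filter⁺)
open import Data.List.Relation.Unary.Any using (here)
import Data.List.Relation.Unary.Any as Any
open import Data.Nat using (ℕ; zero; suc; _+_; _*_; _∸_; _≤_; z≤n; s≤s; s≤s⁻¹; _%_; _/_)
import Data.Nat as ℕ
open import Data.Nat.DivMod using (m%n<n; m≡m%n+[m/n]*n)
open import Data.Nat.Divisibility using (_∣_; divides; _∣0; ∣m∣n⇒∣m+n; ∣m+n∣m⇒∣n; ∣n⇒∣m*n; n∣m*n)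
open import Data.Nat.ListAction using (sum)
open import Data.Nat.Properties
  using ( +-identityʳ; +-comm; +-assoc; +-suc; *-zeroʳ; *-distribˡ-+; suc-injective
        ; +-cancelˡ-≡; +-cancelˡ-≤; m+n≡0⇒m≡0; m+n≡0⇒n≡0; m∸n+n≡m
        ; ≤-refl; ≤-reflexive; ≤-trans; ≤-antisym; m≤m+n; n≤0⇒n≡0; +-commutativeSemigroup )
import Data.Nat.Tactic.RingSolver as ℕ-Solver
open import Data.Product using (_×_; _,_; proj₁; proj₂; swap; ∃-syntax)
open import Data.Sum using (_⊎_; inj₁; inj₂)
open import Data.Unit using (tt)
open import Function using (_∘_)
open import Function.Bundles using (_⇔_; mk⇔)
open import Relation.Binary.PropositionalEquality
open import Relation.Nullary using (yes; no; does; contradiction)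
open import Relation.Nullary.Decidable using (dec-true; dec-false)

open CommutativeSemigroupProperties +-commutativeSemigroup using (interchange)

⟦_⟧ : Bool → ℕ
⟦ b ⟧ = if b then 1 else 0

module _ {n : ℕ} where

  ==-refl : (u : Fin n) → (u == u) ≡ true
  ==-refl u = dec-true (u ≟F u) refl

  ≢⇒==false : {u w : Fin n} → u ≢ w → (u == w) ≡ false
  ≢⇒==false {u} {w} = dec-false (u ≟F w)

  T-==⇒≡ : {u w : Fin n} → T (u == w) → u ≡ w
  T-==⇒≡ {u} {w} u=w with u ≟F w
  ... | yes u≡w = u≡w

  ≡⇒T-== : {u w : Fin n} → u ≡ w → T (u == w)
  ≡⇒T-== {u} refl rewrite ==-refl u = tt

  incident₁ : (w u : Fin n) → T (atZ w (w , u))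
  incident₁ w u rewrite ==-refl w = tt

  incident₂ : (w u : Fin n) → T (atZ w (u , w))
  incident₂ w u rewrite ==-refl w | ∨-zeroʳ (u == w) = tt

  map-allFin-suc : {B : Set} (f : Fin (suc n) → B) →
    map f (allFin (suc n)) ≡ f zero ∷ map (f ∘ suc) (allFin n)
  map-allFin-suc f = cong (f zero ∷_) (trans (map-tabulate suc f) (sym (map-tabulate (λ w → w) (f ∘ suc))))

headᵇ : List Bool → Bool
headᵇ [] = false
headᵇ (b ∷ _) = b

module _ {A : Set} where

  length-filterᵇ-cons : (q : A → Bool) (a : A) (xs : List A) →
    length (filterᵇ q (a ∷ xs)) ≡ ⟦ q a ⟧ + length (filterᵇ q xs)
  length-filterᵇ-cons q a xs with q a
  ... | true  = refl
  ... | false = refl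

  length-filterᵇ-split : (p q : A → Bool) (xs : List A) →
    length (filterᵇ q xs) ≡
    length (filterᵇ q (filterᵇ p xs)) + length (filterᵇ q (filterᵇ (not ∘ p) xs))
  length-filterᵇ-split p q [] = refl
  length-filterᵇ-split p q (a ∷ xs) with p a
  ... | true with q a
  ...   | true  = cong suc (length-filterᵇ-split p q xs)
  ...   | false = length-filterᵇ-split p q xs
  length-filterᵇ-split p q (a ∷ xs) | false with q a
  ...   | true  = trans (cong suc (length-filterᵇ-split p q xs)) (sym (+-suc _ _))
  ...   | false = length-filterᵇ-split p q xs

  1≤length-filterᵇ : (q : A → Bool) {a : A} {xs : List A} → a ∈ xs → T (q a) → 1 ≤ length (filterᵇ q xs)
  1≤length-filterᵇ q a∈xs qa = filter-some (T? ∘ q) (Any.map (λ a≡ → subst (T ∘ q) a≡ qa) a∈xs)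

  sum-map-+ : (f g : A → ℕ) (xs : List A) →
    sum (map (λ a → f a + g a) xs) ≡ sum (map f xs) + sum (map g xs)
  sum-map-+ f g [] = refl
  sum-map-+ f g (a ∷ xs) = trans (cong (f a + g a +_) (sum-map-+ f g xs)) (interchange (f a) (g a) _ _)

  sum-map-* : (k : ℕ) (f : A → ℕ) (xs : List A) → sum (map (λ a → k * f a) xs) ≡ k * sum (map f xs)
  sum-map-* k f [] = sym (*-zeroʳ k)
  sum-map-* k f (a ∷ xs) = trans (cong (k * f a +_) (sum-map-* k f xs)) (sym (*-distribˡ-+ k (f a) _))

  sum-map-zero : (xs : List A) → sum (map (λ _ → 0) xs) ≡ 0
  sum-map-zero [] = refl
  sum-map-zero (a ∷ xs) = sum-map-zero xs

  sum-map-if : (S : A → Bool) (f : A → ℕ) (xs : List A) →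
    sum (map f xs) ≡
    sum (map (λ a → if S a then f a else 0) xs) + sum (map (λ a → if not (S a) then f a else 0) xs)
  sum-map-if S f xs = trans (cong sum (map-cong split xs)) (sum-map-+ _ _ xs)
    where
    split : ∀ a → f a ≡ (if S a then f a else 0) + (if not (S a) then f a else 0)
    split a with S a
    ... | true  = sym (+-identityʳ (f a))
    ... | false = refl

  ∣-sum-map : {d : ℕ} (f : A → ℕ) (xs : List A) → (∀ a → d ∣ f a) → d ∣ sum (map f xs)
  ∣-sum-map f [] d∣f = _ ∣0
  ∣-sum-map f (a ∷ xs) d∣f = ∣m∣n⇒∣m+n (d∣f a) (∣-sum-map f xs d∣f)

  interleave : (A → Bool) → List A → List Bool → List Bool → List Bool
  interleave p [] ψ φ = []
  interleave p (a ∷ xs) ψ φ with p a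
  ... | true  = headᵇ ψ ∷ interleave p xs (drop 1 ψ) φ
  ... | false = headᵇ φ ∷ interleave p xs ψ (drop 1 φ)

  length-interleave : (p : A → Bool) (xs : List A) (ψ φ : List Bool) →
    length (interleave p xs ψ φ) ≡ length xs
  length-interleave p [] ψ φ = refl
  length-interleave p (a ∷ xs) ψ φ with p a
  ... | true  = cong suc (length-interleave p xs (drop 1 ψ) φ)
  ... | false = cong suc (length-interleave p xs ψ (drop 1 φ))

  interleave-not : (p : A → Bool) (xs : List A) (ψ φ : List Bool) →
    interleave (not ∘ p) xs φ ψ ≡ interleave p xs ψ φ
  interleave-not p [] ψ φ = refl
  interleave-not p (a ∷ xs) ψ φ with p a
  ... | true  = cong (headᵇ ψ ∷_) (interleave-not p xs (drop 1 ψ) φ)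
  ... | false = cong (headᵇ φ ∷_) (interleave-not p xs ψ (drop 1 φ))

sum-allFin-indicator : {n : ℕ} (u : Fin n) (f : Fin n → ℕ) →
  sum (map (λ w → if u == w then f w else 0) (allFin n)) ≡ f u
sum-allFin-indicator {suc n} zero f =
  trans (cong sum (map-allFin-suc (λ w → if zero == w then f w else 0)))
        (trans (cong (f zero +_) (sum-map-zero (allFin n))) (+-identityʳ (f zero)))
sum-allFin-indicator {suc n} (suc u) f =
  trans (cong sum (map-allFin-suc (λ w → if suc u == w then f w else 0)))
        (sum-allFin-indicator u (f ∘ suc))

module _ {n : ℕ} where

  reorient : Bool → Fin n × Fin n → Fin n × Fin n
  reorient b e = if b then e else swap e

  atZ-reorient : (w : Fin n) (b : Bool) (e : Fin n × Fin n) → atZ w (reorient b e) ≡ atZ w e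
  atZ-reorient w true e = refl
  atZ-reorient w false e = ∨-comm (proj₂ e == w) (proj₁ e == w)

  filterᵇ-orient-interleave : (p : Fin n × Fin n → Bool) → (∀ b e → p (reorient b e) ≡ p e) →
    (E : Edges n) (ψ φ : List Bool) → length ψ ≡ length (filterᵇ p E) →
    filterᵇ p (orient E (interleave p E ψ φ)) ≡ orient (filterᵇ p E) ψ
  filterᵇ-orient-interleave p p-reorient [] [] φ _ = refl
  filterᵇ-orient-interleave p p-reorient (e ∷ E) ψ φ len with p e in pe
  filterᵇ-orient-interleave p p-reorient (e ∷ E) (b ∷ ψ) φ len | true
    rewrite p-reorient b e | pe =
    cong (reorient b e ∷_) (filterᵇ-orient-interleave p p-reorient E ψ φ (suc-injective len))
  filterᵇ-orient-interleave p p-reorient (e ∷ E) ψ φ len | false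
    rewrite p-reorient (headᵇ φ) e | pe =
    filterᵇ-orient-interleave p p-reorient E ψ (drop 1 φ) len

  orient-loopless : (E : Edges n) (O : List Bool) → Loopless E → Loopless (orient E O)
  orient-loopless [] O [] = []
  orient-loopless (e ∷ E) [] (_ ∷ _) = []
  orient-loopless (e ∷ E) (true ∷ O) (e-loopless ∷ loopless) = e-loopless ∷ orient-loopless E O loopless
  orient-loopless (e ∷ E) (false ∷ O) (e-loopless ∷ loopless) = (e-loopless ∘ sym) ∷ orient-loopless E O loopless

  deg≡outdeg+indeg : (D : Edges n) (w : Fin n) → deg D w ≡ outdeg D w + indeg D w
  deg≡outdeg+indeg [] w = refl
  deg≡outdeg+indeg (d ∷ D) w = begin
    ⟦ proj₁ d == w ⟧ + ⟦ proj₂ d == w ⟧ + deg D w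
      ≡⟨ cong (⟦ proj₁ d == w ⟧ + ⟦ proj₂ d == w ⟧ +_) (deg≡outdeg+indeg D w) ⟩
    ⟦ proj₁ d == w ⟧ + ⟦ proj₂ d == w ⟧ + (outdeg D w + indeg D w)
      ≡⟨ interchange ⟦ proj₁ d == w ⟧ ⟦ proj₂ d == w ⟧ (outdeg D w) (indeg D w) ⟩
    (⟦ proj₁ d == w ⟧ + outdeg D w) + (⟦ proj₂ d == w ⟧ + indeg D w)
      ≡⟨ sym (cong₂ _+_ (length-filterᵇ-cons (λ d → proj₁ d == w) d D) (length-filterᵇ-cons (λ d → proj₂ d == w) d D)) ⟩
    outdeg (d ∷ D) w + indeg (d ∷ D) w ∎
    where open ≡-Reasoning

  deg-orient : (E : Edges n) (O : List Bool) (w : Fin n) → length O ≡ length E →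
    deg (orient E O) w ≡ deg E w
  deg-orient [] [] w _ = refl
  deg-orient (e ∷ E) (true ∷ O) w len = cong (_ +_) (deg-orient E O w (suc-injective len))
  deg-orient (e ∷ E) (false ∷ O) w len =
    cong₂ _+_ (+-comm ⟦ proj₂ e == w ⟧ ⟦ proj₁ e == w ⟧) (deg-orient E O w (suc-injective len))

  deg-filterᵇ-split : (p : Fin n × Fin n → Bool) (E : Edges n) (w : Fin n) →
    deg E w ≡ deg (filterᵇ p E) w + deg (filterᵇ (not ∘ p) E) w
  deg-filterᵇ-split p E w = begin
    deg E w
      ≡⟨ deg≡outdeg+indeg E w ⟩
    outdeg E w + indeg E w
      ≡⟨ cong₂ _+_ (length-filterᵇ-split p _ E) (length-filterᵇ-split p _ E) ⟩
    (outdeg (filterᵇ p E) w + outdeg (filterᵇ (not ∘ p) E) w) +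
    (indeg (filterᵇ p E) w + indeg (filterᵇ (not ∘ p) E) w)
      ≡⟨ interchange (outdeg (filterᵇ p E) w) _ (indeg (filterᵇ p E) w) _ ⟩
    (outdeg (filterᵇ p E) w + indeg (filterᵇ p E) w) +
    (outdeg (filterᵇ (not ∘ p) E) w + indeg (filterᵇ (not ∘ p) E) w)
      ≡⟨ sym (cong₂ _+_ (deg≡outdeg+indeg (filterᵇ p E) w) (deg≡outdeg+indeg (filterᵇ (not ∘ p) E) w)) ⟩
    deg (filterᵇ p E) w + deg (filterᵇ (not ∘ p) E) w ∎
    where open ≡-Reasoning

  deg-incident : (w : Fin n) (L : Edges n) → Loopless L → All (T ∘ atZ w) L → deg L w ≡ length L
  deg-incident w [] [] [] = refl
  deg-incident w ((p , q) ∷ L) (p≢q ∷ loopless) (incident ∷ incidents) with p ≟F w | q ≟F w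
  ... | yes p≡w | yes q≡w = ⊥-elim (p≢q (trans p≡w (sym q≡w)))
  ... | yes _   | no _    = cong suc (deg-incident w L loopless incidents)
  ... | no _    | yes _   = cong suc (deg-incident w L loopless incidents)

  deg-avoiding : (w : Fin n) (L : Edges n) → All (T ∘ not ∘ atZ w) L → deg L w ≡ 0
  deg-avoiding w [] [] = refl
  deg-avoiding w ((p , q) ∷ L) (avoids ∷ avoiding) with p == w | q == w
  ... | false | false = deg-avoiding w L avoiding

  degrees-filter-incident : (D : Edges n) (w : Fin n) →
    outdeg D w ≡ outdeg (filterᵇ (atZ w) D) w × indeg D w ≡ indeg (filterᵇ (atZ w) D) w
  degrees-filter-incident D w =
      trans (length-filterᵇ-split (atZ w) _ D) (trans (cong (outdeg near w +_) out-away≡0) (+-identityʳ _))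
    , trans (length-filterᵇ-split (atZ w) _ D) (trans (cong (indeg near w +_) in-away≡0) (+-identityʳ _))
    where
    near away : Edges n
    near = filterᵇ (atZ w) D
    away = filterᵇ (not ∘ atZ w) D
    deg-away≡0 : outdeg away w + indeg away w ≡ 0
    deg-away≡0 = trans (sym (deg≡outdeg+indeg away w)) (deg-avoiding w away (all-filter (T? ∘ not ∘ atZ w) D))
    out-away≡0 : outdeg away w ≡ 0
    out-away≡0 = m+n≡0⇒m≡0 (outdeg away w) deg-away≡0
    in-away≡0 : indeg away w ≡ 0
    in-away≡0 = m+n≡0⇒n≡0 (outdeg away w) deg-away≡0

  sum-endpoint-count : (end : Fin n × Fin n → Fin n) (D : Edges n) →
    sum (map (λ w → length (filterᵇ (λ d → end d == w) D)) (allFin n)) ≡ length D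
  sum-endpoint-count end [] = sum-map-zero (allFin n)
  sum-endpoint-count end (d ∷ D) = begin
    sum (map (λ w → length (filterᵇ (λ d → end d == w) (d ∷ D))) (allFin n))
      ≡⟨ cong sum (map-cong (λ w → length-filterᵇ-cons (λ d → end d == w) d D) (allFin n)) ⟩
    sum (map (λ w → ⟦ end d == w ⟧ + length (filterᵇ (λ d → end d == w) D)) (allFin n))
      ≡⟨ sum-map-+ _ _ (allFin n) ⟩
    sum (map (λ w → ⟦ end d == w ⟧) (allFin n)) + sum (map (λ w → length (filterᵇ (λ d → end d == w) D)) (allFin n))
      ≡⟨ cong₂ _+_ (sum-allFin-indicator (end d) (λ _ → 1)) (sum-endpoint-count end D) ⟩
    suc (length D) ∎
    where open ≡-Reasoning

module _ {n : ℕ} where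

  -- Orientation bits for edges at v: the first k leave v, the others enter v.
  awayFrom : Fin n → ℕ → Edges n → List Bool
  awayFrom v k [] = []
  awayFrom v zero (e ∷ N) = not (proj₁ e == v) ∷ awayFrom v zero N
  awayFrom v (suc k) (e ∷ N) = (proj₁ e == v) ∷ awayFrom v k N

  length-awayFrom : (v : Fin n) (k : ℕ) (N : Edges n) → length (awayFrom v k N) ≡ length N
  length-awayFrom v k [] = refl
  length-awayFrom v zero (e ∷ N) = cong suc (length-awayFrom v zero N)
  length-awayFrom v (suc k) (e ∷ N) = cong suc (length-awayFrom v k N)

  degrees-leaving : {u v : Fin n} → u ≢ v → (D : Edges n) →
    outdeg ((v , u) ∷ D) v ≡ suc (outdeg D v) × indeg ((v , u) ∷ D) v ≡ indeg D v
  degrees-leaving {u} {v} u≢v D rewrite ==-refl v | ≢⇒==false u≢v = refl , refl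

  degrees-entering : {u v : Fin n} → u ≢ v → (D : Edges n) →
    outdeg ((u , v) ∷ D) v ≡ outdeg D v × indeg ((u , v) ∷ D) v ≡ suc (indeg D v)
  degrees-entering {u} {v} u≢v D rewrite ==-refl v | ≢⇒==false u≢v = refl , refl

  reorient-incident : (v : Fin n) (e : Fin n × Fin n) → proj₁ e ≢ proj₂ e → T (atZ v e) →
    ∃[ u ] u ≢ v × reorient (proj₁ e == v) e ≡ (v , u) × reorient (not (proj₁ e == v)) e ≡ (u , v)
  reorient-incident v (p , q) p≢q incident with p ≟F v
  ... | yes refl = q , p≢q ∘ sym , refl , refl
  ... | no p≢v with refl ← T-==⇒≡ {u = q} incident = p , p≢v , refl , refl

  degrees-awayFrom : (v : Fin n) (k : ℕ) (N : Edges n) → Loopless N → All (T ∘ atZ v) N → k ≤ length N →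
    outdeg (orient N (awayFrom v k N)) v ≡ k × indeg (orient N (awayFrom v k N)) v ≡ length N ∸ k
  degrees-awayFrom v k [] [] [] z≤n = refl , refl
  degrees-awayFrom v zero (e ∷ N) (loopless-e ∷ loopless) (incident ∷ incidents) _
    with reorient-incident v e loopless-e incident | degrees-awayFrom v zero N loopless incidents z≤n
  ... | u , u≢v , _ , entering | out , inn
    rewrite entering =
    trans (proj₁ (degrees-entering u≢v _)) out , trans (proj₂ (degrees-entering u≢v _)) (cong suc inn)
  degrees-awayFrom v (suc k) (e ∷ N) (loopless-e ∷ loopless) (incident ∷ incidents) (s≤s k≤)
    with reorient-incident v e loopless-e incident | degrees-awayFrom v k N loopless incidents k≤
  ... | u , u≢v , leaving , _ | out , inn
    rewrite leaving =
    trans (proj₁ (degrees-leaving u≢v _)) (cong suc out) , trans (proj₂ (degrees-leaving u≢v _)) inn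

module _ {n : ℕ} {E : Edges n} {z x : Fin n} where

  reach-tip : Loopless E → (∀ w → w ≢ z → Reach E x w) →
    {e : Fin n × Fin n} → e ∈ zEdges E z → Reach E x z
  reach-tip loopless reach {p , q} e∈ with ∈-filter⁻ (T? ∘ atZ z) {xs = E} e∈
  ... | e∈E , at-z with p ≟F z
  ...   | yes refl = step (reach q (All.lookup loopless e∈E ∘ sym)) (inj₂ e∈E)
  ...   | no p≢z with refl ← T-==⇒≡ {u = q} at-z = step (reach p p≢z) (inj₁ e∈E)

  reach-avoids-isolated-tip : zEdges E z ≡ [] → x ≢ z → ∀ {w} → Reach E x w → w ≢ z
  reach-avoids-isolated-tip isolated x≢z here = x≢z
  reach-avoids-isolated-tip isolated x≢z (step {u} r (inj₁ e∈E)) refl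
    with () ← subst ((u , z) ∈_) isolated (∈-filter⁺ (T? ∘ atZ z) e∈E (incident₂ z u))
  reach-avoids-isolated-tip isolated x≢z (step {u} r (inj₂ e∈E)) refl
    with () ← subst ((z , u) ∈_) isolated (∈-filter⁺ (T? ∘ atZ z) e∈E (incident₁ z u))

module _ {n : ℕ} where

  tau≡0⇒β≡0 : (E : Edges n) (β : Fin n → Z3) (v : Fin n) → tau E β v ≡ 0 → β v ≡ zero
  tau≡0⇒β≡0 E β v τ≡0 with does (deg E v % 2 ℕ.≟ 0) | β v ≟F zero
  ... | _ | yes β≡0 = β≡0
  ... | true | no _ with () ← τ≡0
  ... | false | no _ with () ← τ≡0

-- o − i ≡ b (mod 3), written without subtraction: o + 2(i + b) = (o − i − b) + 3(i + b).
Balanced : ℕ → ℕ → ℕ → Set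
Balanced o i b = 3 ∣ o + 2 * (i + b)

module _ (o i b : ℕ) where

  private
    shift-by-multiple-of-3 : pos (o + 2 * (i + b)) ≡ ((pos o ℤ.- pos i) ℤ.- pos b) ℤ.+ pos 3 ℤ.* (pos i ℤ.+ pos b)
    shift-by-multiple-of-3 = begin
      pos (o + 2 * (i + b))                               ≡⟨ ℤ.pos-+ o (2 * (i + b)) ⟩
      pos o ℤ.+ pos (2 * (i + b))                         ≡⟨ cong (λ s → pos o ℤ.+ s) (ℤ.pos-* 2 (i + b)) ⟩
      pos o ℤ.+ pos 2 ℤ.* pos (i + b)                     ≡⟨ cong (λ s → pos o ℤ.+ pos 2 ℤ.* s) (ℤ.pos-+ i b) ⟩
      pos o ℤ.+ pos 2 ℤ.* (pos i ℤ.+ pos b)               ≡⟨ identity (pos o) (pos i) (pos b) ⟩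
      ((pos o ℤ.- pos i) ℤ.- pos b) ℤ.+ pos 3 ℤ.* (pos i ℤ.+ pos b) ∎
      where
      open ≡-Reasoning
      identity : ∀ O I B → O ℤ.+ pos 2 ℤ.* (I ℤ.+ B) ≡ ((O ℤ.- I) ℤ.- B) ℤ.+ pos 3 ℤ.* (I ℤ.+ B)
      identity = ℤ-Solver.solve-∀

    3∣3* : ∀ m → pos 3 ℤ∣.∣ pos 3 ℤ.* m
    3∣3* m = ℤ∣.∣m⇒∣m*n m ℤ∣.∣-refl

  ≡₃⇒Balanced : (pos o ℤ.- pos i) ≡₃ pos b → Balanced o i b
  ≡₃⇒Balanced o-i≡b = ℤ∣.∣⇒∣ᵤ (subst (ℤ∣._∣_ (pos 3)) (sym shift-by-multiple-of-3)
    (ℤ∣.∣m∣n⇒∣m+n {i = pos 3} {m = (pos o ℤ.- pos i) ℤ.- pos b} (ℤ∣.∣ᵤ⇒∣ o-i≡b) (3∣3* (pos i ℤ.+ pos b))))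

  Balanced⇒≡₃ : Balanced o i b → (pos o ℤ.- pos i) ≡₃ pos b
  Balanced⇒≡₃ balanced = ℤ∣.∣⇒∣ᵤ (ℤ∣.∣m+n∣n⇒∣m {i = pos 3} {m = (pos o ℤ.- pos i) ℤ.- pos b}
    (subst (ℤ∣._∣_ (pos 3)) shift-by-multiple-of-3 (ℤ∣.∣ᵤ⇒∣ balanced)) (3∣3* (pos i ℤ.+ pos b)))

3∣2b⇒3∣b : ∀ b → 3 ∣ 2 * b → 3 ∣ b
3∣2b⇒3∣b b 3∣2b = ∣m+n∣m⇒∣n (subst (3 ∣_) (sym (thrice b)) (n∣m*n b)) 3∣2b
  where
  thrice : ∀ b → 2 * b + b ≡ b * 3
  thrice = ℕ-Solver.solve-∀

module _ {n : ℕ} where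

  BalancedAt : Edges n → (Fin n → Z3) → Fin n → Set
  BalancedAt D β w = Balanced (outdeg D w) (indeg D w) (toℕ (β w))

  BalancedAt⇒≡₃ : {D : Edges n} {β : Fin n → Z3} {w : Fin n} →
    BalancedAt D β w → excess D w ≡₃ pos (toℕ (β w))
  BalancedAt⇒≡₃ {D} {β} {w} = Balanced⇒≡₃ (outdeg D w) (indeg D w) (toℕ (β w))

  -- Summing o + 2(i + b) over all vertices gives 3|D| + 2 Σβ.
  balanced-at-last : (D : Edges n) (β : Fin n → Z3) (x : Fin n) → 3 ∣ sumOver (λ _ → true) β →
    (∀ w → w ≢ x → BalancedAt D β w) → BalancedAt D β x
  balanced-at-last D β x 3∣Σβ balanced = ∣m+n∣m⇒∣n (subst (3 ∣_) (sym total) 3∣3L+2Σβ) 3∣rest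
    where
    t : Fin n → ℕ
    t w = outdeg D w + 2 * (indeg D w + toℕ (β w))

    Σ : (Fin n → ℕ) → ℕ
    Σ f = sum (map f (allFin n))

    rest : ℕ
    rest = Σ (λ w → if not (x == w) then t w else 0)

    total : rest + t x ≡ length D + 2 * (length D + sumOver (λ _ → true) β)
    total = begin
      rest + t x
        ≡⟨ +-comm rest (t x) ⟩
      t x + rest
        ≡⟨ cong (_+ rest) (sym (sum-allFin-indicator x t)) ⟩
      Σ (λ w → if x == w then t w else 0) + rest
        ≡⟨ sym (sum-map-if (x ==_) t (allFin n)) ⟩
      Σ t
        ≡⟨ sum-map-+ (outdeg D) _ (allFin n) ⟩
      Σ (outdeg D) + Σ (λ w → 2 * (indeg D w + toℕ (β w)))
        ≡⟨ cong₂ _+_ (sum-endpoint-count proj₁ D) (sum-map-* 2 _ (allFin n)) ⟩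
      length D + 2 * Σ (λ w → indeg D w + toℕ (β w))
        ≡⟨ cong (λ s → length D + 2 * s) (sum-map-+ (indeg D) _ (allFin n)) ⟩
      length D + 2 * (Σ (indeg D) + Σ (toℕ ∘ β))
        ≡⟨ cong (λ s → length D + 2 * (s + Σ (toℕ ∘ β))) (sum-endpoint-count proj₂ D) ⟩
      length D + 2 * (length D + sumOver (λ _ → true) β) ∎
      where open ≡-Reasoning

    3∣3L+2Σβ : 3 ∣ length D + 2 * (length D + sumOver (λ _ → true) β)
    3∣3L+2Σβ = subst (3 ∣_) (sym (regroup (length D) (sumOver (λ _ → true) β)))
      (∣m∣n⇒∣m+n (n∣m*n (length D)) (∣n⇒∣m*n 2 3∣Σβ))
      where
      regroup : ∀ L s → L + 2 * (L + s) ≡ L * 3 + 2 * s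
      regroup = ℕ-Solver.solve-∀

    3∣rest : 3 ∣ rest
    3∣rest = ∣-sum-map _ (allFin n) term
      where
      term : ∀ w → 3 ∣ (if not (x == w) then t w else 0)
      term w with x ≟F w
      ... | yes _   = _ ∣0
      ... | no  x≢w = balanced w (x≢w ∘ sym)

Balanceable : ℕ → ℕ → ℕ → ℕ → Set
Balanceable o i c b = ∃[ k ] k ≤ c × Balanced (o + k) (i + (c ∸ k)) b

-- With k of the c free edges leaving and c − k entering, o + 2(i + b) becomes m + 2k − 3k for
-- m = o + 2(i + c + b), so k = m mod 3 works: then m + 2k ≡ 3m ≡ 0.
balanceable-≥2 : ∀ o i c b → 2 ≤ c → Balanceable o i c b
balanceable-≥2 o i c b 2≤c = k , k≤c , ∣m+n∣m⇒∣n (subst (3 ∣_) (sym shifted) 3∣m+2k) (n∣m*n k)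
  where
  m k : ℕ
  m = o + 2 * (i + c + b)
  k = m % 3

  k≤c : k ≤ c
  k≤c = ≤-trans (s≤s⁻¹ (m%n<n m 3)) 2≤c

  3∣m+2k : 3 ∣ m + 2 * k
  3∣m+2k = subst (3 ∣_) (sym (trans (cong (_+ 2 * k) (m≡m%n+[m/n]*n m 3)) (regroup k (m / 3)))) (n∣m*n (k + m / 3))
    where
    regroup : ∀ k q → k + q * 3 + 2 * k ≡ (k + q) * 3
    regroup = ℕ-Solver.solve-∀

  shifted : k * 3 + ((o + k) + 2 * ((i + (c ∸ k)) + b)) ≡ m + 2 * k
  shifted = trans (shift o i (c ∸ k) k b) (cong (λ c′ → o + 2 * (i + c′ + b) + 2 * k) (m∸n+n≡m k≤c))
    where
    shift : ∀ o i l k b → k * 3 + ((o + k) + 2 * ((i + l) + b)) ≡ o + 2 * (i + (l + k) + b) + 2 * k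
    shift = ℕ-Solver.solve-∀

balanceable-1 : ∀ o i → o + i ≡ 3 → 1 ≤ o → 1 ≤ i → Balanceable o i 1 0
balanceable-1 1 2 _ _ _ = 1 , ≤-refl , divides 2 refl
balanceable-1 2 1 _ _ _ = 0 , z≤n , divides 2 refl
balanceable-1 3 0 _ _ ()

module Extension {n : ℕ} (G : Easel n) where
  open Easel G

  P N : Edges n
  P = orient (zEdges E z) ψ
  N = filterᵇ (not ∘ atZ z) E

  tip-balanced : (O : List Bool) → filterᵇ (atZ z) (orient E O) ≡ P → BalancedAt (orient E O) β z
  tip-balanced O agrees =
    subst₂ (λ o i → Balanced o i (toℕ (β z)))
      (sym (trans (proj₁ at-z) (cong (λ D → outdeg D z) agrees)))
      (sym (trans (proj₂ at-z) (cong (λ D → indeg D z) agrees)))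
      (≡₃⇒Balanced (outdeg P z) (indeg P z) (toℕ (β z)) (proj₂ preflow))
    where
    at-z = degrees-filter-incident (orient E O) z

  boundary-sum-zero : (∀ w → w ≢ z → Reach E x w) → 3 ∣ sumOver (λ _ → true) β
  boundary-sum-zero reach with zEdges E z in tip-edges | proj₂ preflow
  ... | e ∷ _ | _ = boundary x (λ _ → true) (λ w → mk⇔ (λ _ → reach-all w) (λ _ → refl))
    where
    reach-all : ∀ w → Reach E x w
    reach-all w with w ≟F z
    ... | yes refl = reach-tip loopless reach (subst (e ∈_) (sym tip-edges) (here refl))
    ... | no w≢z   = reach w w≢z
  ... | [] | z-balanced = subst (3 ∣_) (sym split) (∣m∣n⇒∣m+n 3∣βz (boundary x off-z component))
    where
    off-z : Fin n → Bool
    off-z w = not (z == w)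

    3∣βz : 3 ∣ toℕ (β z)
    3∣βz = 3∣2b⇒3∣b (toℕ (β z)) (≡₃⇒Balanced 0 0 (toℕ (β z)) z-balanced)

    component : ∀ w → (off-z w ≡ true) ⇔ Reach E x w
    component w = mk⇔ to from
      where
      to : off-z w ≡ true → Reach E x w
      to off with z ≟F w
      ... | no z≢w = reach w (z≢w ∘ sym)
      from : Reach E x w → off-z w ≡ true
      from r = cong not (≢⇒==false (reach-avoids-isolated-tip tip-edges x≢z r ∘ sym))

    split : sumOver (λ _ → true) β ≡ toℕ (β z) + sumOver off-z β
    split = trans (sum-map-if (z ==_) (toℕ ∘ β) (allFin n))
                  (cong (_+ sumOver off-z β) (sum-allFin-indicator z (toℕ ∘ β)))

  -- x is balanced by counting once β sums to 0, which holds as x reaches all but possibly an isolated z.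
  extends-if-balanced-off-z-and-x : (∀ w → w ≢ z → Reach E x w) →
    (O : List Bool) → length O ≡ length E → filterᵇ (atZ z) (orient E O) ≡ P →
    (∀ w → w ≢ z → w ≢ x → BalancedAt (orient E O) β w) → Extends E β z ψ
  extends-if-balanced-off-z-and-x reach O length-O agrees balanced =
    O , (length-O , λ w → BalancedAt⇒≡₃ {D = D} {β} {w} (balanced-everywhere w)) , agrees
    where
    D : Edges n
    D = orient E O

    balanced-off-x : ∀ w → w ≢ x → BalancedAt D β w
    balanced-off-x w w≢x with w ≟F z
    ... | yes refl = tip-balanced O agrees
    ... | no w≢z   = balanced w w≢z w≢x

    balanced-everywhere : ∀ w → BalancedAt D β w
    balanced-everywhere w with w ≟F x
    ... | yes refl = balanced-at-last D β x (boundary-sum-zero reach) balanced-off-x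
    ... | no w≢x   = balanced-off-x w w≢x

  tipOrientation : List Bool → List Bool
  tipOrientation φ = interleave (atZ z) E ψ φ

  tipOrientation-agrees : (φ : List Bool) → filterᵇ (atZ z) (orient E (tipOrientation φ)) ≡ P
  tipOrientation-agrees φ = filterᵇ-orient-interleave (atZ z) (atZ-reorient z) E ψ φ (proj₁ preflow)

  tipOrientation-elsewhere : (φ : List Bool) → length φ ≡ length N →
    filterᵇ (not ∘ atZ z) (orient E (tipOrientation φ)) ≡ orient N φ
  tipOrientation-elsewhere φ length-φ =
    trans (cong (λ O → filterᵇ (not ∘ atZ z) (orient E O)) (sym (interleave-not (atZ z) E ψ φ)))
          (filterᵇ-orient-interleave (not ∘ atZ z) (λ b e → cong not (atZ-reorient z b e)) E φ ψ length-φ)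

  degrees-tipOrientation : (φ : List Bool) → length φ ≡ length N → (w : Fin n) →
    let D = orient E (tipOrientation φ) in
    outdeg D w ≡ outdeg P w + outdeg (orient N φ) w × indeg D w ≡ indeg P w + indeg (orient N φ) w
  degrees-tipOrientation φ length-φ w =
      trans (length-filterᵇ-split (atZ z) _ D) (cong₂ (λ A B → outdeg A w + outdeg B w) agrees elsewhere)
    , trans (length-filterᵇ-split (atZ z) _ D) (cong₂ (λ A B → indeg A w + indeg B w) agrees elsewhere)
    where
    D = orient E (tipOrientation φ)
    agrees = tipOrientation-agrees φ
    elsewhere = tipOrientation-elsewhere φ length-φ

  extends-on-two-vertices : (∀ w → w ≢ z → w ≡ x) → Extends E β z ψ
  extends-on-two-vertices only-x =
    extends-if-balanced-off-z-and-x reach (tipOrientation []) (length-interleave (atZ z) E ψ [])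
      (tipOrientation-agrees []) (λ w w≢z w≢x → ⊥-elim (w≢x (only-x w w≢z)))
    where
    reach : ∀ w → w ≢ z → Reach E x w
    reach w w≢z rewrite only-x w w≢z = here

  module _ (v : Fin n) (v≢z : v ≢ z) (v≢x : v ≢ x) (only-v : ∀ w → w ≢ z → w ≢ x → w ≡ v) where

    ZE : Edges n
    ZE = zEdges E z

    loopless-ZE : Loopless ZE
    loopless-ZE = filter⁺ (T? ∘ atZ z) loopless

    loopless-N : Loopless N
    loopless-N = filter⁺ (T? ∘ not ∘ atZ z) loopless

    ∈N⇒∈E : ∀ {e} → e ∈ N → e ∈ E
    ∈N⇒∈E = proj₁ ∘ ∈-filter⁻ (T? ∘ not ∘ atZ z) {xs = E}

    JoinsXV : Fin n × Fin n → Set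
    JoinsXV e = e ≡ (x , v) ⊎ e ≡ (v , x)

    joins-x-v : (e : Fin n × Fin n) → proj₁ e ≢ proj₂ e → T (not (atZ z e)) → JoinsXV e
    joins-x-v (p , q) p≢q avoids-z with p ≟F z | q ≟F z
    ... | no p≢z | no q≢z with p ≟F x | q ≟F x
    ...   | yes refl | yes refl = ⊥-elim (p≢q refl)
    ...   | yes refl | no q≢x   = inj₁ (cong (x ,_) (only-v q q≢z q≢x))
    ...   | no p≢x   | yes refl = inj₂ (cong (_, x) (only-v p p≢z p≢x))
    ...   | no p≢x   | no q≢x   = ⊥-elim (p≢q (trans (only-v p p≢z p≢x) (sym (only-v q q≢z q≢x))))

    N-joins-x-v : All JoinsXV N
    N-joins-x-v = All.zipWith (λ (e-loopless , e-avoids) → joins-x-v _ e-loopless e-avoids)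
                              (loopless-N , all-filter (T? ∘ not ∘ atZ z) E)

    N-at-x : All (T ∘ atZ x) N
    N-at-x = All.map (λ { (inj₁ refl) → incident₁ x v ; (inj₂ refl) → incident₂ x v }) N-joins-x-v

    N-at-v : All (T ∘ atZ v) N
    N-at-v = All.map (λ { (inj₁ refl) → incident₂ v x ; (inj₂ refl) → incident₁ v x }) N-joins-x-v

    exactly-one : ∀ u → ⟦ u == z ⟧ + ⟦ u == x ⟧ + ⟦ u == v ⟧ ≡ 1
    exactly-one u with u ≟F z | u ≟F x | u ≟F v
    ... | yes refl | yes refl | _        = ⊥-elim (x≢z refl)
    ... | yes refl | no _     | yes refl = ⊥-elim (v≢z refl)
    ... | yes refl | no _     | no _     = refl
    ... | no _     | yes refl | yes refl = ⊥-elim (v≢x refl)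
    ... | no _     | yes refl | no _     = refl
    ... | no _     | no _     | yes refl = refl
    ... | no u≢z   | no u≢x   | no u≢v   = ⊥-elim (u≢v (only-v u u≢z u≢x))

    deg-sum : (L : Edges n) → deg L z + deg L x + deg L v ≡ 2 * length L
    deg-sum [] = refl
    deg-sum ((p , q) ∷ L) = begin
      (⟦ p == z ⟧ + ⟦ q == z ⟧ + deg L z) + (⟦ p == x ⟧ + ⟦ q == x ⟧ + deg L x) + (⟦ p == v ⟧ + ⟦ q == v ⟧ + deg L v)
        ≡⟨ regroup ⟦ p == z ⟧ ⟦ q == z ⟧ (deg L z) ⟦ p == x ⟧ ⟦ q == x ⟧ (deg L x) ⟦ p == v ⟧ ⟦ q == v ⟧ (deg L v) ⟩
      (⟦ p == z ⟧ + ⟦ p == x ⟧ + ⟦ p == v ⟧) + (⟦ q == z ⟧ + ⟦ q == x ⟧ + ⟦ q == v ⟧) + (deg L z + deg L x + deg L v)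
        ≡⟨ cong₂ (λ s t → s + t + (deg L z + deg L x + deg L v)) (exactly-one p) (exactly-one q) ⟩
      2 + (deg L z + deg L x + deg L v)
        ≡⟨ cong (2 +_) (deg-sum L) ⟩
      2 + 2 * length L
        ≡⟨ sym (*-distribˡ-+ 2 1 (length L)) ⟩
      2 * length ((p , q) ∷ L) ∎
      where
      open ≡-Reasoning
      regroup : ∀ a b c d e f g h i → (a + b + c) + (d + e + f) + (g + h + i) ≡ (a + d + g) + (b + e + h) + (c + f + i)
      regroup = ℕ-Solver.solve-∀

    deg-E-split : ∀ w → deg E w ≡ deg ZE w + deg N w
    deg-E-split = deg-filterᵇ-split (atZ z) E

    deg-ZE-z : deg ZE z ≡ length ZE
    deg-ZE-z = deg-incident z ZE loopless-ZE (all-filter (T? ∘ atZ z) E)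

    deg-E-z : deg E z ≡ length ZE
    deg-E-z = trans (deg-E-split z) (trans (cong₂ _+_ deg-ZE-z (deg-avoiding z N (all-filter (T? ∘ not ∘ atZ z) E)))
                                           (+-identityʳ _))

    deg-E-x : deg E x ≡ deg ZE x + length N
    deg-E-x = trans (deg-E-split x) (cong (deg ZE x +_) (deg-incident x N loopless-N N-at-x))

    deg-E-v : deg E v ≡ deg ZE v + length N
    deg-E-v = trans (deg-E-split v) (cong (deg ZE v +_) (deg-incident v N loopless-N N-at-v))

    deg-ZE-x+v : deg ZE x + deg ZE v ≡ length ZE
    deg-ZE-x+v = +-cancelˡ-≡ (length ZE) _ _ (begin
      length ZE + (deg ZE x + deg ZE v)   ≡⟨ sym (+-assoc (length ZE) _ _) ⟩
      length ZE + deg ZE x + deg ZE v     ≡⟨ cong (λ d → d + deg ZE x + deg ZE v) (sym deg-ZE-z) ⟩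
      deg ZE z + deg ZE x + deg ZE v      ≡⟨ deg-sum ZE ⟩
      2 * length ZE                       ≡⟨ cong (length ZE +_) (+-identityʳ (length ZE)) ⟩
      length ZE + length ZE ∎)
      where open ≡-Reasoning

    deg-P-v : outdeg P v + indeg P v ≡ deg ZE v
    deg-P-v = trans (sym (deg≡outdeg+indeg P v)) (deg-orient ZE ψ v (proj₁ preflow))

    few-z-v-edges : Tall G → deg ZE v ≤ length N + 2
    few-z-v-edges (z≤x+2 , _) = +-cancelˡ-≤ (deg ZE x) _ _
      (subst₂ _≤_ (trans deg-E-z (sym deg-ZE-x+v))
                  (trans (cong (_+ 2) deg-E-x) (+-assoc (deg ZE x) (length N) 2)) z≤x+2)

    many-at-v : Tame G → 4 + tau E β v ≤ deg ZE v + length N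
    many-at-v tame = subst (4 + tau E β v ≤_) deg-E-v (tame v v≢x v≢z)

    N-nonempty : Tall G → Tame G → 1 ≤ length N
    N-nonempty tall tame with length N | few-z-v-edges tall | many-at-v tame
    ... | suc _ | _ | _ = s≤s z≤n
    ... | zero | b≤2 | 4+τ≤b+0
      with s≤s (s≤s ()) ← ≤-trans (m≤m+n 4 _) (≤-trans 4+τ≤b+0 (≤-trans (≤-reflexive (+-identityʳ _)) b≤2))

    reach-v : 1 ≤ length N → Reach E x v
    reach-v 1≤c with N in N-eq | N-joins-x-v
    ... | _ ∷ _ | inj₁ refl ∷ _ = step here (inj₁ (∈N⇒∈E (subst (_ ∈_) (sym N-eq) (here refl))))
    ... | _ ∷ _ | inj₂ refl ∷ _ = step here (inj₂ (∈N⇒∈E (subst (_ ∈_) (sym N-eq) (here refl))))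

    loopless-P : Loopless P
    loopless-P = orient-loopless ZE ψ loopless-ZE

    -- With a single x–v edge, tameness and tallness leave no slack: v has exactly 3 edges to z,
    -- τ(v) = 0, and tallness makes ψ send one of them into z and one out of z.
    balanceable-at-v-tight : Tall G → Tame G → length N ≡ 1 →
      Balanceable (outdeg P v) (indeg P v) 1 (toℕ (β v))
    balanceable-at-v-tight tall tame c≡1 =
      subst (Balanceable (outdeg P v) (indeg P v) 1) (sym (cong toℕ β≡0))
        (balanceable-1 (outdeg P v) (indeg P v) (trans deg-P-v b≡3) 1≤outdeg 1≤indeg)
      where
      b : ℕ
      b = deg ZE v

      b≤3 : b ≤ 3
      b≤3 = subst (λ c → b ≤ c + 2) c≡1 (few-z-v-edges tall)

      4+τ≤b+1 : 4 + tau E β v ≤ b + 1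
      4+τ≤b+1 = subst (λ c → 4 + tau E β v ≤ b + c) c≡1 (many-at-v tame)

      b≡3 : b ≡ 3
      b≡3 = ≤-antisym b≤3 (s≤s⁻¹ (subst (4 ≤_) (+-comm b 1) (≤-trans (m≤m+n 4 _) 4+τ≤b+1)))

      β≡0 : β v ≡ zero
      β≡0 = tau≡0⇒β≡0 E β v (n≤0⇒n≡0 (+-cancelˡ-≤ 4 _ 0 (subst (λ b → 4 + tau E β v ≤ b + 1) b≡3 4+τ≤b+1)))

      z-tight : deg E z ≡ deg E x + 2
      z-tight = begin
        deg E z                  ≡⟨ trans deg-E-z (sym deg-ZE-x+v) ⟩
        deg ZE x + b             ≡⟨ cong (deg ZE x +_) b≡3 ⟩
        deg ZE x + (1 + 2)       ≡⟨ sym (+-assoc (deg ZE x) 1 2) ⟩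
        deg ZE x + 1 + 2         ≡⟨ cong (λ c → deg ZE x + c + 2) (sym c≡1) ⟩
        deg ZE x + length N + 2  ≡⟨ cong (_+ 2) (sym deg-E-x) ⟩
        deg E x + 2 ∎
        where open ≡-Reasoning

      1≤outdeg : 1 ≤ outdeg P v
      1≤outdeg with (d , d∈P , d→z , d≢x) ← proj₁ (proj₂ tall z-tight) =
        1≤length-filterᵇ (λ d → proj₁ d == v) d∈P
          (≡⇒T-== (only-v (proj₁ d) (λ d≡z → All.lookup loopless-P d∈P (trans d≡z (sym d→z))) d≢x))

      1≤indeg : 1 ≤ indeg P v
      1≤indeg with (d , d∈P , z→d , d≢x) ← proj₂ (proj₂ tall z-tight) =
        1≤length-filterᵇ (λ d → proj₂ d == v) d∈P
          (≡⇒T-== (only-v (proj₂ d) (λ d≡z → All.lookup loopless-P d∈P (trans z→d (sym d≡z))) d≢x))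

    balanceable-at-v : Tall G → Tame G → Balanceable (outdeg P v) (indeg P v) (length N) (toℕ (β v))
    balanceable-at-v tall tame with length N in c-eq | N-nonempty tall tame
    ... | 1           | _ = balanceable-at-v-tight tall tame c-eq
    ... | suc (suc c) | _ = balanceable-≥2 (outdeg P v) (indeg P v) (suc (suc c)) (toℕ (β v)) (s≤s (s≤s z≤n))

    extends-on-three-vertices : Tall G → Tame G → Extends E β z ψ
    extends-on-three-vertices tall tame with balanceable-at-v tall tame
    ... | k , k≤c , balanced =
      extends-if-balanced-off-z-and-x reach (tipOrientation φ) (length-interleave (atZ z) E ψ φ)
        (tipOrientation-agrees φ) balanced-at-v
      where
      φ : List Bool
      φ = awayFrom v k N

      reach : ∀ w → w ≢ z → Reach E x w
      reach w w≢z with w ≟F x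
      ... | yes refl = here
      ... | no w≢x rewrite only-v w w≢z w≢x = reach-v (N-nonempty tall tame)

      balanced-at-v : ∀ w → w ≢ z → w ≢ x → BalancedAt (orient E (tipOrientation φ)) β w
      balanced-at-v w w≢z w≢x rewrite only-v w w≢z w≢x =
        subst₂ (λ o i → Balanced o i (toℕ (β v)))
          (sym (trans (proj₁ D-at-v) (cong (outdeg P v +_) (proj₁ Q-at-v))))
          (sym (trans (proj₂ D-at-v) (cong (indeg P v +_) (proj₂ Q-at-v))))
          balanced
        where
        D-at-v = degrees-tipOrientation φ (length-awayFrom v k N) v
        Q-at-v = degrees-awayFrom v k N loopless-N N-at-v k≤c

pattern 0F = zero
pattern 1F = suc zero
pattern 2F = suc (suc zero)

other-vertex : (z x w : Fin 2) → x ≢ z → w ≢ z → w ≡ x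
other-vertex 0F 0F _  x≢z _   = contradiction refl x≢z
other-vertex 1F 1F _  x≢z _   = contradiction refl x≢z
other-vertex 0F 1F 0F _   w≢z = contradiction refl w≢z
other-vertex 0F 1F 1F _   _   = refl
other-vertex 1F 0F 0F _   _   = refl
other-vertex 1F 0F 1F _   w≢z = contradiction refl w≢z

third-vertex : (z x : Fin 3) → x ≢ z → ∃[ v ] v ≢ z × v ≢ x × (∀ w → w ≢ z → w ≢ x → w ≡ v)
third-vertex 0F 1F _ = 2F , (λ ()) , (λ ()) , λ
  { 0F w≢z _ → contradiction refl w≢z
  ; 1F _ w≢x → contradiction refl w≢x
  ; 2F _ _   → refl }
third-vertex 0F 2F _ = 1F , (λ ()) , (λ ()) , λ
  { 0F w≢z _ → contradiction refl w≢z
  ; 2F _ w≢x → contradiction refl w≢x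
  ; 1F _ _   → refl }
third-vertex 1F 0F _ = 2F , (λ ()) , (λ ()) , λ
  { 1F w≢z _ → contradiction refl w≢z
  ; 0F _ w≢x → contradiction refl w≢x
  ; 2F _ _   → refl }
third-vertex 1F 2F _ = 0F , (λ ()) , (λ ()) , λ
  { 1F w≢z _ → contradiction refl w≢z
  ; 2F _ w≢x → contradiction refl w≢x
  ; 0F _ _   → refl }
third-vertex 2F 0F _ = 1F , (λ ()) , (λ ()) , λ
  { 2F w≢z _ → contradiction refl w≢z
  ; 0F _ w≢x → contradiction refl w≢x
  ; 1F _ _   → refl }
third-vertex 2F 1F _ = 0F , (λ ()) , (λ ()) , λ
  { 2F w≢z _ → contradiction refl w≢z
  ; 1F _ w≢x → contradiction refl w≢x
  ; 0F _ _   → refl }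
third-vertex 0F 0F x≢z = contradiction refl x≢z
third-vertex 1F 1F x≢z = contradiction refl x≢z
third-vertex 2F 2F x≢z = contradiction refl x≢z

mainTheorem15 : ∀ (n : ℕ) (G : Easel n) → Tall G → Tame G → Critical G → 4 ≤ n
mainTheorem15 0 G _ _ _ with () ← Easel.z G
mainTheorem15 1 record { z = 0F ; x = 0F ; x≢z = x≢z } _ _ _ = contradiction refl x≢z
mainTheorem15 2 G _ _ (no-extension , _) =
  contradiction (Extension.extends-on-two-vertices G (λ w → other-vertex z x w x≢z)) no-extension
  where open Easel G
mainTheorem15 3 G tall tame (no-extension , _) with third-vertex (Easel.z G) (Easel.x G) (Easel.x≢z G)
... | v , v≢z , v≢x , only-v =
  contradiction (Extension.extends-on-three-vertices G v v≢z v≢x only-v tall tame) no-extension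
mainTheorem15 (suc (suc (suc (suc n)))) _ _ _ _ = s≤s (s≤s (s≤s (s≤s z≤n)))
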